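{- Let $\Gamma$ be a numerical semigroup of multiplicity $m$ with $W_\Gamma(m)=0$. Then $t(\Gamma)=m-1$. In particular, $t(\Gamma)=m-1$ whenever $\Gamma=\langle m,qm+1,\ldots,qm+(m-1)\rangle$ for integers $m>1$, $q>0$.
   Context: A numerical semigroup is an additive submonoid $\Gamma\subseteq\mathbb{N}$ with finite complement, with multiplicity $m=\min(\Gamma\setminus\{0\})$, conductor $c(\Gamma)$ (one more than the largest integer not in $\Gamma$) and delta-invariant $\delta(\Gamma)=|\{x\in\Gamma:x<c(\Gamma)\}|$. The Wilf function is $W_\Gamma(k)=k\delta(\Gamma)-c(\Gamma)$. On $\Gamma$ define the partial order $s\preceq t$ iff $t-s\in\Gamma$. With $\mathrm{Ap}(\Gamma,m)=\{w\in\Gamma: w-m\notin\Gamma\}$, the type $t(\Gamma)$ is the number of elements of $\mathrm{Ap}(\Gamma,m)\setminus\{0\}$ that are maximal with respect to $\preceq$ (within $\mathrm{Ap}(\Gamma,m)\setminus\{0\}$). -}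

module Defs where

open import Data.Nat using (ℕ; zero; suc; _+_; _*_; _∸_; _≤_; _<_)
open import Data.Integer as ℤ using (ℤ; +_)
open import Data.List using (List; []; _∷_; length; filter; upTo; map)
open import Data.List.Membership.Propositional using (_∈_)
open import Data.List.Relation.Unary.Unique.Propositional using (Unique)
open import Data.Product using (Σ; ∃; _×_; _,_)
open import Relation.Nullary using (¬_)
open import Relation.Binary.PropositionalEquality using (_≡_; _≢_)
open import Relation.Unary using (Pred; Decidable)
open import Function.Bundles using (_⇔_)

record NumericalSemigroup : Set₁ where
  field
    Mem      : Pred ℕ _
    Mem?     : Decidable Mem
    zero∈    : Mem 0
    +-closed : ∀ {a b} → Mem a → Mem b → Mem (a + b)
    cofinite : ∃ λ N → ∀ n → N ≤ n → Mem n
open NumericalSemigroup public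

IsMultiplicity : NumericalSemigroup → ℕ → Set
IsMultiplicity Γ m = (0 < m) × Mem Γ m × (∀ x → 0 < x → Mem Γ x → m ≤ x)

IsConductor : NumericalSemigroup → ℕ → Set
IsConductor Γ c = (∀ n → c ≤ n → Mem Γ n)
                × (∀ c' → (∀ n → c' ≤ n → Mem Γ n) → c ≤ c')

delta : NumericalSemigroup → ℕ → ℕ
delta Γ c = length (filter (Mem? Γ) (upTo c))

Wilf : NumericalSemigroup → ℕ → ℕ → ℤ
Wilf Γ c k = + (k * delta Γ c) ℤ.- + c

_⪯[_]_ : ℕ → NumericalSemigroup → ℕ → Set
s ⪯[ Γ ] t = Σ (s ≤ t) λ _ → Mem Γ (t ∸ s)

-- Apéry set Ap(Γ, m) = {w ∈ Γ : w − m ∉ Γ}  (w − m < 0 counts as ∉ Γ)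
InApery : NumericalSemigroup → ℕ → ℕ → Set
InApery Γ m w = Mem Γ w × ¬ (Σ (m ≤ w) λ _ → Mem Γ (w ∸ m))

MaxApery : NumericalSemigroup → ℕ → ℕ → Set
MaxApery Γ m w = InApery Γ m w × w ≢ 0
               × (∀ w' → InApery Γ m w' → w' ≢ 0 → w ⪯[ Γ ] w' → w' ≡ w)

HasType : NumericalSemigroup → ℕ → ℕ → Set
HasType Γ m t = ∃ λ (L : List ℕ) → Unique L
              × (∀ x → (x ∈ L) ⇔ MaxApery Γ m x) × length L ≡ t

data Generated (gens : List ℕ) : ℕ → Set where
  gen-zero : Generated gens 0
  gen-add  : ∀ {g x} → g ∈ gens → Generated gens x → Generated gens (g + x)

specialGens : ℕ → ℕ → List ℕ
specialGens m q = m ∷ map (λ i → q * m + suc i) (upTo (m ∸ 1))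

-- W_Γ(m) = 0 says c = δm. The δ multiples 0, m, …, (δ−1)m of m lie in Γ below c, and Γ has
-- only δ elements below c, so these are all of them: Γ = mℕ ∪ [qm, ∞) with q = δ. For such Γ
-- the nonzero Apéry elements are qm + 1, …, qm + m − 1; any two differ by a positive number
-- smaller than m, hence not in Γ, so all m − 1 of them are maximal. The semigroup
-- ⟨m, qm + 1, …, qm + m − 1⟩ is exactly mℕ ∪ [qm, ∞).
module Submission where

open import Defs
open import Data.Nat using (ℕ; _∸_; _<_)
open import Data.Integer using (0ℤ)
open import Data.Product using (_×_)
open import Relation.Binary.PropositionalEquality using (_≡_; _≢_)
open import Function.Bundles using (_⇔_)

open import Data.Nat using (zero; suc; _+_; _*_; _≤_; z≤n; s≤s; z<s)
open import Data.Nat.Properties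
open import Data.Nat.Divisibility using (_∣_; divides; _∣?_; ∣m+n∣m⇒∣n; ∣⇒≤; n∣m*n; ∣m∣n⇒∣m+n; ∣-refl; _∣0)
open import Data.Nat.DivMod using (_%_; _/_; m≡m%n+[m/n]*n; m%n<n)
open import Data.Integer.Properties using (i-j≡0⇒i≡j; +-injective)
open import Data.List using (List; [_]; length; filter; upTo; _++_; map)
open import Data.List.Properties using (upTo-∷ʳ; filter-++; filter-accept; length-++; length-map; length-upTo)
open import Data.List.Membership.Propositional using (_∈_)
open import Data.List.Membership.Propositional.Properties using (∈-map⁺; ∈-map⁻; ∈-upTo⁺; ∈-upTo⁻; ∈-filter⁺; ∈-filter⁻)
open import Data.List.Relation.Unary.Any using (here; there)
open import Data.List.Relation.Unary.Unique.Propositional.Properties using (map⁺; upTo⁺)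
open import Data.List.Relation.Binary.Sublist.Propositional as Sublist using (⊆-refl)
open import Data.List.Relation.Binary.Sublist.Propositional.Properties using (filter⁺; length-mono-≤; to-≋)
open import Data.List.Relation.Binary.Equality.Propositional using (≋⇒≡)
open import Data.Product using (Σ; _,_; proj₁; proj₂)
open import Data.Sum using (_⊎_; inj₁; inj₂; [_,_]′)
open import Data.Empty using (⊥-elim)
open import Function.Base using (_∘_)
open import Function.Bundles using (mk⇔; Equivalence)
open import Relation.Nullary using (¬_; yes; no; contradiction)
open import Relation.Unary using (Pred; Decidable; _⊆_)
open import Relation.Binary.PropositionalEquality using (refl; sym; trans; cong; subst; module ≡-Reasoning)

open Equivalence using (to; from)

module _ {p} {P : Pred ℕ p} (P? : Decidable P) where

  countBelow : ℕ → ℕ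
  countBelow n = length (filter P? (upTo n))

  countBelow-suc : ∀ n → countBelow (suc n) ≡ countBelow n + length (filter P? [ n ])
  countBelow-suc n = begin
    length (filter P? (upTo (suc n)))                     ≡⟨ cong (length ∘ filter P?) (upTo-∷ʳ n) ⟨
    length (filter P? (upTo n ++ [ n ]))                  ≡⟨ cong length (filter-++ P? (upTo n) [ n ]) ⟩
    length (filter P? (upTo n) ++ filter P? [ n ])        ≡⟨ length-++ (filter P? (upTo n)) ⟩
    countBelow n + length (filter P? [ n ])               ∎
    where open ≡-Reasoning

  countBelow-suc-accept : ∀ {n} → P n → countBelow (suc n) ≡ suc (countBelow n)
  countBelow-suc-accept {n} pn = begin
    countBelow (suc n)                      ≡⟨ countBelow-suc n ⟩
    countBelow n + length (filter P? [ n ]) ≡⟨ cong ((countBelow n +_) ∘ length) (filter-accept P? pn) ⟩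
    countBelow n + 1                        ≡⟨ +-comm (countBelow n) 1 ⟩
    suc (countBelow n)                      ∎
    where open ≡-Reasoning

  countBelow-mono : ∀ {n n′} → n ≤ n′ → countBelow n ≤ countBelow n′
  countBelow-mono {n′ = zero} z≤n = ≤-refl
  countBelow-mono {n′ = suc n′} n≤1+n′ with m≤n⇒m<n∨m≡n n≤1+n′
  ... | inj₁ n<1+n′ = ≤-trans (countBelow-mono (≤-pred n<1+n′))
                              (≤-trans (m≤m+n _ _) (≤-reflexive (sym (countBelow-suc n′))))
  ... | inj₂ refl   = ≤-refl

multiples-countBelow : ∀ {m} → 0 < m → ∀ k → k ≤ countBelow (m ∣?_) (k * m)
multiples-countBelow _ zero = z≤n
multiples-countBelow {m} 0<m (suc k) = begin
  suc k                             ≤⟨ s≤s (multiples-countBelow 0<m k) ⟩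
  suc (countBelow (m ∣?_) (k * m))  ≡⟨ countBelow-suc-accept (m ∣?_) (n∣m*n k) ⟨
  countBelow (m ∣?_) (suc (k * m))  ≤⟨ countBelow-mono (m ∣?_) (+-monoˡ-≤ (k * m) 0<m) ⟩
  countBelow (m ∣?_) (m + k * m)    ∎
  where open ≤-Reasoning

module _ {p q} {P : Pred ℕ p} {Q : Pred ℕ q} (P? : Decidable P) (Q? : Decidable Q) (P⊆Q : P ⊆ Q) where

  filterBelow-sublist : ∀ n → filter P? (upTo n) Sublist.⊆ filter Q? (upTo n)
  filterBelow-sublist n = filter⁺ P? Q? (λ { refl → P⊆Q }) (⊆-refl {x = upTo n})

  countBelow-⊆ : ∀ n → countBelow P? n ≤ countBelow Q? n
  countBelow-⊆ n = length-mono-≤ (filterBelow-sublist n)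

  countBelow-≡⇒⊇ : ∀ {n x} → countBelow P? n ≡ countBelow Q? n → x < n → Q x → P x
  countBelow-≡⇒⊇ {n} {x} same x<n qx = proj₂ (∈-filter⁻ P? {xs = upTo n} x∈filterP)
    where
    filters-equal : filter P? (upTo n) ≡ filter Q? (upTo n)
    filters-equal = ≋⇒≡ (to-≋ same (filterBelow-sublist n))
    x∈filterP : x ∈ filter P? (upTo n)
    x∈filterP = subst (x ∈_) (sym filters-equal) (∈-filter⁺ Q? (∈-upTo⁺ x<n) qx)

∈Γ-multiple : ∀ Γ {m} → Mem Γ m → ∀ k → Mem Γ (k * m)
∈Γ-multiple Γ m∈Γ zero    = zero∈ Γ
∈Γ-multiple Γ m∈Γ (suc k) = +-closed Γ m∈Γ (∈Γ-multiple Γ m∈Γ k)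

∈Γ-∣ : ∀ Γ {m x} → Mem Γ m → m ∣ x → Mem Γ x
∈Γ-∣ Γ m∈Γ (divides k refl) = ∈Γ-multiple Γ m∈Γ k

IsMultiplesOrAbove : NumericalSemigroup → ℕ → ℕ → Set
IsMultiplesOrAbove Γ m c = ∀ x → Mem Γ x ⇔ (m ∣ x ⊎ c ≤ x)

m∣a⇒m∤a+r : ∀ {m a r} → m ∣ a → 0 < r → r < m → ¬ (m ∣ a + r)
m∣a⇒m∤a+r {r = suc _} m∣a _ r<m m∣a+r = <⇒≱ r<m (∣⇒≤ (∣m+n∣m⇒∣n m∣a+r m∣a))

module MaximalApery (Γ : NumericalSemigroup) (m′ q′ : ℕ)
  (Γ≐ : IsMultiplesOrAbove Γ (suc m′) (suc q′ * suc m′)) where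

  private
    m c : ℕ
    m = suc m′
    c = suc q′ * m

  shifted : ℕ → ℕ
  shifted i = c + suc i

  maximalApery : List ℕ
  maximalApery = map shifted (upTo m′)

  m∈Γ : Mem Γ m
  m∈Γ = from (Γ≐ m) (inj₁ ∣-refl)

  apery-∤ : ∀ {w} → InApery Γ m w → w ≢ 0 → ¬ (m ∣ w)
  apery-∤ _          w≢0 (divides zero w≡0)   = w≢0 w≡0
  apery-∤ (_ , notm) _   (divides (suc k) refl) =
    notm (m≤m+n m (k * m) , subst (Mem Γ) (sym (m+n∸m≡n m (k * m))) (∈Γ-multiple Γ m∈Γ k))

  apery-≥ : ∀ {w} → InApery Γ m w → w ≢ 0 → c ≤ w
  apery-≥ ap w≢0 with to (Γ≐ _) (proj₁ ap)
  ... | inj₁ m∣w = ⊥-elim (apery-∤ ap w≢0 m∣w)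
  ... | inj₂ c≤w = c≤w

  apery-< : ∀ {w} → InApery Γ m w → w < c + m
  apery-< {w} (_ , notm) with w <? c + m
  ... | yes w<c+m = w<c+m
  ... | no  w≮c+m = ⊥-elim (notm (≤-trans (m≤n+m m c) c+m≤w , w∸m∈Γ))
    where
    c+m≤w = ≮⇒≥ w≮c+m
    w∸m∈Γ = from (Γ≐ _) (inj₂ (m+n≤o⇒m≤o∸n c c+m≤w))

  shifted-apery : ∀ {i} → suc i < m → InApery Γ m (shifted i)
  shifted-apery {i} 1+i<m = from (Γ≐ _) (inj₂ (m≤m+n c (suc i))) , below-not-in-Γ
    where
    shifted∸m : shifted i ∸ m ≡ q′ * m + suc i
    shifted∸m = trans (cong (_∸ m) (+-assoc m (q′ * m) (suc i))) (m+n∸m≡n m _)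
    below-not-in-Γ : ¬ (Σ (m ≤ shifted i) λ _ → Mem Γ (shifted i ∸ m))
    below-not-in-Γ (_ , mem) with to (Γ≐ _) (subst (Mem Γ) shifted∸m mem)
    ... | inj₁ m∣ = m∣a⇒m∤a+r (n∣m*n q′) z<s 1+i<m m∣
    ... | inj₂ c≤ = <⇒≱ 1+i<m
                      (+-cancelˡ-≤ (q′ * m) _ _ (subst (_≤ q′ * m + suc i) (+-comm m (q′ * m)) c≤))

  shifted-maximal : ∀ {i w} → InApery Γ m w → shifted i ⪯[ Γ ] w → w ≡ shifted i
  shifted-maximal {i} {w} ap (s≤w , mem) with w ∸ shifted i in w∸s≡d
  ... | zero  = ≤-antisym (m∸n≡0⇒m≤n w∸s≡d) s≤w
  ... | suc d = contradiction (apery-< ap) (<-asym c+m<w)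
    where
    m≤1+d : m ≤ suc d
    m≤1+d with to (Γ≐ _) mem
    ... | inj₁ m∣ = ∣⇒≤ m∣
    ... | inj₂ c≤ = ≤-trans (m≤m+n m _) c≤
    c+m<w : c + m < w
    c+m<w = begin-strict
      c + m           <⟨ +-monoˡ-< m (m<m+n c z<s) ⟩
      shifted i + m   ≤⟨ +-monoʳ-≤ (shifted i) m≤1+d ⟩
      shifted i + suc d ≡⟨ cong (shifted i +_) w∸s≡d ⟨
      shifted i + (w ∸ shifted i) ≡⟨ m+[n∸m]≡n s≤w ⟩
      w ∎
      where open ≤-Reasoning

  ∈⇒maxApery : ∀ {x} → x ∈ maximalApery → MaxApery Γ m x
  ∈⇒maxApery x∈ with ∈-map⁻ shifted x∈
  ... | i , i∈ , refl = shifted-apery (s≤s (∈-upTo⁻ i∈)) , m+1+n≢0 c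
                      , λ _ ap _ ⪯w → shifted-maximal ap ⪯w

  maxApery⇒∈ : ∀ {x} → MaxApery Γ m x → x ∈ maximalApery
  maxApery⇒∈ {x} (ap , x≢0 , _) with x ∸ c in x∸c≡d
  ... | zero  = ⊥-elim (apery-∤ ap x≢0 (subst (m ∣_) c≡x (n∣m*n (suc q′))))
    where c≡x = ≤-antisym (apery-≥ ap x≢0) (m∸n≡0⇒m≤n x∸c≡d)
  ... | suc i = subst (_∈ maximalApery) shifted≡x (∈-map⁺ shifted (∈-upTo⁺ (≤-pred 1+i<m)))
    where
    shifted≡x : shifted i ≡ x
    shifted≡x = trans (cong (c +_) (sym x∸c≡d)) (m+[n∸m]≡n (apery-≥ ap x≢0))
    1+i<m : suc i < m
    1+i<m = +-cancelˡ-< c _ _ (subst (_< c + m) (sym shifted≡x) (apery-< ap))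

  multiplesOrAbove-type : HasType Γ m m′
  multiplesOrAbove-type =
    maximalApery , map⁺ shifted-injective (upTo⁺ m′) ,
    (λ x → mk⇔ ∈⇒maxApery maxApery⇒∈) ,
    trans (length-map shifted (upTo m′)) (length-upTo m′)
    where
    shifted-injective : ∀ {i j} → shifted i ≡ shifted j → i ≡ j
    shifted-injective = suc-injective ∘ +-cancelˡ-≡ c _ _

wilf-zero⇒conductor≡δm : ∀ Γ m c → Wilf Γ c m ≡ 0ℤ → c ≡ delta Γ c * m
wilf-zero⇒conductor≡δm Γ m c W≡0 =
  trans (sym (+-injective (i-j≡0⇒i≡j _ _ W≡0))) (*-comm m (delta Γ c))

∈Γ-below-conductor⇒∣ : ∀ Γ {m c x} → 0 < m → Mem Γ m → c ≡ delta Γ c * m →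
                       x < c → Mem Γ x → m ∣ x
∈Γ-below-conductor⇒∣ Γ {m} {c} 0<m m∈Γ c≡δm =
  countBelow-≡⇒⊇ (m ∣?_) (Mem? Γ) (∈Γ-∣ Γ m∈Γ)
    (≤-antisym (countBelow-⊆ (m ∣?_) (Mem? Γ) (∈Γ-∣ Γ m∈Γ) c) δ≤multiples)
  where
  δ≤multiples : delta Γ c ≤ countBelow (m ∣?_) c
  δ≤multiples = subst (λ n → delta Γ c ≤ countBelow (m ∣?_) n) (sym c≡δm)
                      (multiples-countBelow 0<m (delta Γ c))

conductor≡δm⇒multiplesOrAbove : ∀ Γ {m c} → IsMultiplicity Γ m → IsConductor Γ c →
                                c ≡ delta Γ c * m → IsMultiplesOrAbove Γ m c
conductor≡δm⇒multiplesOrAbove Γ {m} {c} (0<m , m∈Γ , _) (above-c , _) c≡δm x =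
  mk⇔ classify [ ∈Γ-∣ Γ m∈Γ , above-c x ]′
  where
  classify : Mem Γ x → m ∣ x ⊎ c ≤ x
  classify x∈Γ with x <? c
  ... | yes x<c = inj₁ (∈Γ-below-conductor⇒∣ Γ 0<m m∈Γ c≡δm x<c x∈Γ)
  ... | no  x≮c = inj₂ (≮⇒≥ x≮c)

-- When c = 0 (so Γ = ℕ and m = 1) the threshold is raised to m, since MaximalApery needs c ≥ m.
conductor-zero⇒multiplesOrAbove : ∀ Γ {m} → IsMultiplicity Γ m → IsConductor Γ 0 →
                                  IsMultiplesOrAbove Γ m (1 * m)
conductor-zero⇒multiplesOrAbove Γ {m} (_ , _ , least) (above-0 , _) x =
  mk⇔ (classify x) (λ _ → above-0 x z≤n)
  where
  classify : ∀ x → Mem Γ x → m ∣ x ⊎ 1 * m ≤ x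
  classify zero    _   = inj₁ (m ∣0)
  classify (suc x) x∈Γ = inj₂ (subst (_≤ suc x) (sym (*-identityˡ m)) (least (suc x) z<s x∈Γ))

wilf-zero⇒type : (Γ : NumericalSemigroup) (m c : ℕ) → IsMultiplicity Γ m → IsConductor Γ c →
                 Wilf Γ c m ≡ 0ℤ → HasType Γ m (m ∸ 1)
wilf-zero⇒type Γ (suc m′) c mult cond W≡0 =
  type-from (delta Γ c) c≡δm (conductor≡δm⇒multiplesOrAbove Γ mult cond c≡δm)
  where
  c≡δm : c ≡ delta Γ c * suc m′
  c≡δm = wilf-zero⇒conductor≡δm Γ (suc m′) c W≡0
  type-from : ∀ δ → c ≡ δ * suc m′ → IsMultiplesOrAbove Γ (suc m′) c → HasType Γ (suc m′) m′
  type-from zero     c≡0  _  = MaximalApery.multiplesOrAbove-type Γ m′ 0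
    (conductor-zero⇒multiplesOrAbove Γ mult (subst (IsConductor Γ) c≡0 cond))
  type-from (suc q′) c≡qm Γ≐ = MaximalApery.multiplesOrAbove-type Γ m′ q′
    (subst (IsMultiplesOrAbove Γ (suc m′)) c≡qm Γ≐)

module _ {gens : List ℕ} where

  generated-+ : ∀ {a b} → Generated gens a → Generated gens b → Generated gens (a + b)
  generated-+ gen-zero              gb = gb
  generated-+ (gen-add {g} {x} g∈ ga) gb =
    subst (Generated gens) (sym (+-assoc g x _)) (gen-add g∈ (generated-+ ga gb))

  generated-multiple : ∀ {g} → g ∈ gens → ∀ k → Generated gens (k * g)
  generated-multiple g∈ zero    = gen-zero
  generated-multiple g∈ (suc k) = gen-add g∈ (generated-multiple g∈ k)

module SpecialGenerators (m′ q′ : ℕ) where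

  private
    m c : ℕ
    m = suc m′
    c = suc q′ * m
    gens : List ℕ
    gens = specialGens m (suc q′)

  generated-multiple-of-m : ∀ k → Generated gens (k * m)
  generated-multiple-of-m = generated-multiple (here refl)

  generated⇒∣-or-≥ : ∀ {x} → Generated gens x → m ∣ x ⊎ c ≤ x
  generated⇒∣-or-≥ gen-zero = inj₁ (m ∣0)
  generated⇒∣-or-≥ (gen-add (here refl) gx) with generated⇒∣-or-≥ gx
  ... | inj₁ m∣x = inj₁ (∣m∣n⇒∣m+n ∣-refl m∣x)
  ... | inj₂ c≤x = inj₂ (≤-trans c≤x (m≤n+m _ m))
  generated⇒∣-or-≥ (gen-add (there g∈) _) with ∈-map⁻ (λ i → c + suc i) g∈
  ... | i , _ , refl = inj₂ (≤-trans (m≤m+n c (suc i)) (m≤m+n _ _))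

  generated-above-by-residue : ∀ r → r < m → Generated gens (c + r)
  generated-above-by-residue zero    _     =
    subst (Generated gens) (sym (+-identityʳ c)) (generated-multiple-of-m (suc q′))
  generated-above-by-residue (suc i) 1+i<m =
    subst (Generated gens) (+-identityʳ (c + suc i))
      (gen-add (there (∈-map⁺ _ (∈-upTo⁺ (≤-pred 1+i<m)))) gen-zero)

  ∣-or-≥⇒generated : ∀ {x} → m ∣ x ⊎ c ≤ x → Generated gens x
  ∣-or-≥⇒generated (inj₁ (divides k refl)) = generated-multiple-of-m k
  ∣-or-≥⇒generated {x} (inj₂ c≤x) =
    subst (Generated gens) x≡
      (generated-+ (generated-above-by-residue ((x ∸ c) % m) (m%n<n (x ∸ c) m))
                   (generated-multiple-of-m ((x ∸ c) / m)))
    where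
    x≡ : c + (x ∸ c) % m + (x ∸ c) / m * m ≡ x
    x≡ = begin
      c + (x ∸ c) % m + (x ∸ c) / m * m   ≡⟨ +-assoc c _ _ ⟩
      c + ((x ∸ c) % m + (x ∸ c) / m * m) ≡⟨ cong (c +_) (m≡m%n+[m/n]*n (x ∸ c) m) ⟨
      c + (x ∸ c)                         ≡⟨ m+[n∸m]≡n c≤x ⟩
      x                                   ∎
      where open ≡-Reasoning

  specialGens-multiplesOrAbove : ∀ {Γ} → (∀ x → Mem Γ x ⇔ Generated gens x) →
                                 IsMultiplesOrAbove Γ m c
  specialGens-multiplesOrAbove Γ≐gens x =
    mk⇔ (generated⇒∣-or-≥ ∘ to (Γ≐gens x)) (from (Γ≐gens x) ∘ ∣-or-≥⇒generated)

specialGens⇒type : (m q : ℕ) → 1 < m → 0 < q → (Γ : NumericalSemigroup) →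
                   (∀ x → Mem Γ x ⇔ Generated (specialGens m q) x) → HasType Γ m (m ∸ 1)
specialGens⇒type (suc m′) (suc q′) _ _ Γ Γ≐gens =
  MaximalApery.multiplesOrAbove-type Γ m′ q′
    (SpecialGenerators.specialGens-multiplesOrAbove m′ q′ {Γ} Γ≐gens)

corollary3p4 :
    ((Γ : NumericalSemigroup) (m c : ℕ) → IsMultiplicity Γ m → IsConductor Γ c →
      Wilf Γ c m ≡ 0ℤ → HasType Γ m (m ∸ 1))
    × ((m q : ℕ) → 1 < m → 0 < q → (Γ : NumericalSemigroup) →
      (∀ x → Mem Γ x ⇔ Generated (specialGens m q) x) → HasType Γ m (m ∸ 1))
corollary3p4 = wilf-zero⇒type , specialGens⇒type
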